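{- For all $r,k\ge 2$ and $1 \le \ell < k$, we have \[ R_r(P_{n}^{(k,\ell)})> (r-1) \left\lceil\frac{n-\ell}{(k-\ell)\lceil\frac{k}{k-\ell}\rceil}\right\rceil + n -r \ge \left( 1+ \frac{r-1}{(k-\ell)\lceil\frac{k}{k-\ell}\rceil}\right) n-2r+1. \] In particular, when $k-\ell$ divides $k$, $R_r(P_{n}^{(k,\ell)})>\frac{r-1+k}{k} n -2r+1$, and when $1\leq \ell\leq k/2$, $R_r(P_{n}^{(k,\ell)})>\frac{r-1+2(k-\ell)}{2(k-\ell)} n -2r+1$.
   Context: A $k$-graph is a $k$-uniform hypergraph. For hypergraphs $G,H$ and an integer $r\ge 1$, $G\to_r H$ means that every $r$-coloring of the edges of $G$ contains a monochromatic copy of $H$; $R_r(H)$ is the minimum number of vertices of a $k$-graph $G$ with $G\to_r H$. For $1\le \ell\le k-1$ and $m\ge 1$, the $(k,\ell)$-path with $m$ edges is the $k$-graph with vertex set $\{v_1,\dots,v_{k+(m-1)(k-\ell)}\}$ and edges $\{v_{(i-1)(k-\ell)+1},\dots,v_{(i-1)(k-\ell)+k}\}$ for $i\in[m]$; $P_n^{(k,\ell)}$ denotes the $(k,\ell)$-path with $n$ vertices (so $n=\ell+m(k-\ell)$). -}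

module Defs where

open import Data.Nat as ℕ using (ℕ; zero; suc; _+_; _*_; _∸_; _<_; _≤_)
open import Data.Nat.DivMod using (_/_)
open import Data.Integer as ℤ using (ℤ; +_)
open import Data.Rational as ℚ using (ℚ)
open import Data.Fin using (Fin)
open import Data.Fin.Subset using (Subset; ⁅_⁆; ⋃; ∣_∣)
open import Data.List using (List; map; upTo)
open import Data.Product using (Σ; ∃; ∃-syntax; _×_)
open import Relation.Binary.PropositionalEquality using (_≡_)
open import Relation.Nullary using (¬_)

-- ceiling division on ℕ: ⌈ a / d ⌉ (convention: value 0 when d = 0; only used with d > 0)
⌈_/_⌉ : ℕ → ℕ → ℕ
⌈ a / zero ⌉ = 0
⌈ a / suc d ⌉ = (a + d) / suc d

-- rational number p / d (convention: 0 when d = 0; only used with d > 0)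
_/ℚ_ : ℤ → ℕ → ℚ
p /ℚ zero = ℚ.0ℚ
p /ℚ suc d = p ℚ./ suc d

ℕ→ℚ : ℕ → ℚ
ℕ→ℚ n = (+ n) ℚ./ 1

record KGraph (k N : ℕ) : Set₁ where
  field
    Edge    : Subset N → Set
    uniform : ∀ e → Edge e → ∣ e ∣ ≡ k
open KGraph public

Colouring : ∀ {k N} → ℕ → KGraph k N → Set
Colouring {k} {N} r G = (e : Subset N) → Edge G e → Fin r

-- The (k,ℓ)-path with m edges has vertices 0,…,k+(m-1)(k-ℓ)-1 (0-based)
-- and edges {i(k-ℓ) + j : j < k} for i < m.
pathVertices : (k ℓ m : ℕ) → ℕ
pathVertices k ℓ m = k + (m ∸ 1) * (k ∸ ℓ)

edgeImage : ∀ {N} (k ℓ : ℕ) → (ℕ → Fin N) → ℕ → Subset N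
edgeImage k ℓ f i = ⋃ (map (λ j → ⁅ f (i * (k ∸ ℓ) + j) ⁆) (upTo k))

MonoPathCopy : ∀ {k N r} (ℓ m : ℕ) (G : KGraph k N) → Colouring r G → Set
MonoPathCopy {k} {N} {r} ℓ m G χ =
  Σ (ℕ → Fin N) λ f →
    (∀ a b → a < pathVertices k ℓ m → b < pathVertices k ℓ m → f a ≡ f b → a ≡ b) ×
    ∃[ c ] (∀ i → i < m →
      Σ (Edge G (edgeImage k ℓ f i)) λ p → χ (edgeImage k ℓ f i) p ≡ c)

Arrows : ∀ {k N} → KGraph k N → (r ℓ m : ℕ) → Set
Arrows G r ℓ m = ∀ χ → MonoPathCopy {r = r} ℓ m G χ

-- R_r(P^{(k,ℓ)} with m edges) > q  :  no k-graph on N vertices with N ≤ q arrows the path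
-- (R_r is the minimum number of vertices of an arrowing k-graph)
RamseyGreater : (r k ℓ m : ℕ) → ℚ → Set₁
RamseyGreater r k ℓ m q =
  ∀ N → ℕ→ℚ N ℚ.≤ q → (G : KGraph k N) → ¬ Arrows G r ℓ m

{-# OPTIONS --safe #-}
-- Split the N ≤ (n − 1) + (r − 1)(T − 1) vertices into consecutive blocks, block 0 of size n − 1 and
-- blocks 1, …, r − 1 of size T − 1, where T = ⌈(n − ℓ)/D⌉, and colour each edge by the largest block
-- it meets. A monochromatic path of colour 0 lies inside block 0, which cannot hold its n vertices.
-- In a path of colour c ≥ 1 the edges whose index is a multiple of ⌈k/(k − ℓ)⌉ start
-- D = (k − ℓ)⌈k/(k − ℓ)⌉ ≥ k vertices apart, so T of them are pairwise disjoint, and each meets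
-- block c, which has only T − 1 vertices. The linear bounds follow from T·D ≥ n − ℓ, together with
-- D = k when (k − ℓ) ∣ k and D = 2(k − ℓ) when 2ℓ ≤ k.

module Submission where

open import Defs
open import Data.Nat using (ℕ; _+_; _*_; _∸_; _≤_; _<_)
open import Data.Nat.Divisibility using (_∣_)
open import Data.Integer using (+_)
open import Data.Rational using (ℚ; 1ℚ) renaming (_≤_ to _≤ℚ_; _+_ to _+ℚ_; _*_ to _*ℚ_; _-_ to _-ℚ_)
open import Data.Product using (_×_)

open import Data.Empty using (⊥; ⊥-elim)
open import Data.Fin as Fin using (Fin; toℕ; fromℕ<)
open import Data.Fin.Properties using (toℕ-injective; toℕ-fromℕ<; toℕ<n; injective⇒≤)
open import Data.Fin.Subset using (Subset; _∈_; ⋃; inside; outside)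
open import Data.Fin.Subset.Properties using (x∈⁅x⁆; x∈⁅y⁆⇒x≡y; x∈p∪q⁺; x∈p∪q⁻; ∉⊥)
import Data.Integer as ℤ
import Data.Integer.Properties as ℤ
open import Data.Integer.Tactic.RingSolver using (solve-∀)
open import Data.List using (List; []; _∷_)
open import Data.List.Relation.Unary.Any as Any using (Any)
open import Data.List.Relation.Unary.Any.Properties using (map⁺; map⁻; applyUpTo⁺; applyUpTo⁻)
open import Data.Nat using (zero; suc; NonZero; >-nonZero; >-nonZero⁻¹; z≤n; z<s; s≤s; s≤s⁻¹; _⊔_; _<?_)
open import Data.Nat.DivMod using (_/_; _%_; m≡m%n+[m/n]*n; m%n<n; m/n*n≤m; m*n/n≡m; m<n⇒m/n≡0; +-distrib-/-∣ˡ; m<n*o⇒m/o<n)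
open import Data.Nat.Divisibility using (divides; n∣m*n)
open import Data.Nat.Properties
open import Algebra.Properties.CommutativeSemigroup +-commutativeSemigroup using (x∙yz≈y∙xz)
import Data.Nat.Tactic.RingSolver as ℕ-Ring
open import Data.Product using (∃; ∃₂; _,_; proj₁; proj₂)
open import Data.Rational using (toℚᵘ; -_)
import Data.Rational.Properties as ℚ
open import Data.Rational.Solver using (module +-*-Solver)
open import Data.Rational.Unnormalised as ℚᵘ using (mkℚᵘ; *≡*; *≤*) renaming (_≃_ to _≃ᵘ_)
import Data.Rational.Unnormalised.Properties as ℚᵘ
open import Data.Sum using (inj₁; inj₂)
open import Data.Vec using ([]; _∷_; here; there)
open import Function using (_∘_; id)
open import Relation.Nullary using (¬_; yes; no)
open import Relation.Binary.PropositionalEquality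

m≤⌈m/n⌉*n : ∀ m n .{{_ : NonZero n}} → m ≤ ⌈ m / n ⌉ * n
m≤⌈m/n⌉*n m (suc n) = +-cancelʳ-≤ n m (q * suc n) (begin
  m + n                       ≡⟨ m≡m%n+[m/n]*n (m + n) (suc n) ⟩
  (m + n) % suc n + q * suc n ≤⟨ +-monoˡ-≤ (q * suc n) (s≤s⁻¹ (m%n<n (m + n) (suc n))) ⟩
  n + q * suc n               ≡⟨ +-comm n (q * suc n) ⟩
  q * suc n + n               ∎)
  where
  open ≤-Reasoning
  q : ℕ
  q = ⌈ m / suc n ⌉

⌈m/n⌉*n<m+n : ∀ m n .{{_ : NonZero n}} → ⌈ m / n ⌉ * n < m + n
⌈m/n⌉*n<m+n m (suc n) = begin-strict
  (m + n) / suc n * suc n ≤⟨ m/n*n≤m (m + n) (suc n) ⟩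
  m + n                   <⟨ +-monoʳ-< m (n<1+n n) ⟩
  m + suc n               ∎
  where open ≤-Reasoning

m≤c*n<m+n⇒⌈m/n⌉≡c : ∀ {m n} c .{{_ : NonZero n}} → m ≤ c * n → c * n < m + n → ⌈ m / n ⌉ ≡ c
m≤c*n<m+n⇒⌈m/n⌉≡c {m} {n} c m≤cn cn<m+n = ≤-antisym
  (below (⌈m/n⌉*n<m+n m n) m≤cn)
  (below cn<m+n (m≤⌈m/n⌉*n m n))
  where
  below : ∀ {a b} → a * n < m + n → m ≤ b * n → a ≤ b
  below {a} {b} an<m+n m≤bn = s≤s⁻¹ (*-cancelʳ-< n a (suc b)
    (<-≤-trans an<m+n (≤-trans (+-monoˡ-≤ n m≤bn) (≤-reflexive (+-comm (b * n) n)))))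

m≤n*⌈m/n⌉ : ∀ m n .{{_ : NonZero n}} → m ≤ n * ⌈ m / n ⌉
m≤n*⌈m/n⌉ m n = subst (m ≤_) (*-comm ⌈ m / n ⌉ n) (m≤⌈m/n⌉*n m n)

⌈m/n⌉>0 : ∀ {m} n .{{_ : NonZero n}} → 0 < m → 0 < ⌈ m / n ⌉
⌈m/n⌉>0 {m} n 0<m = *-cancelʳ-< n 0 ⌈ m / n ⌉ (<-≤-trans 0<m (m≤⌈m/n⌉*n m n))

q<⌈m/n⌉⇒q*n<m : ∀ {q m n} .{{_ : NonZero n}} → q < ⌈ m / n ⌉ → q * n < m
q<⌈m/n⌉⇒q*n<m {q} {m} {n} q<⌈m/n⌉ = +-cancelʳ-< n (q * n) m (begin-strict
  q * n + n     ≡⟨ +-comm (q * n) n ⟩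
  suc q * n     ≤⟨ *-monoˡ-≤ n q<⌈m/n⌉ ⟩
  ⌈ m / n ⌉ * n <⟨ ⌈m/n⌉*n<m+n m n ⟩
  m + n         ∎)
  where open ≤-Reasoning

m≤⌈[m∸o]/n⌉*n+n : ∀ m {n o} .{{_ : NonZero n}} → o ≤ n → m ≤ ⌈ (m ∸ o) / n ⌉ * n + n
m≤⌈[m∸o]/n⌉*n+n m {n} {o} o≤n = begin
  m                         ≤⟨ m≤n+m∸n m o ⟩
  o + (m ∸ o)               ≤⟨ +-mono-≤ o≤n (m≤⌈m/n⌉*n (m ∸ o) n) ⟩
  n + ⌈ (m ∸ o) / n ⌉ * n   ≡⟨ +-comm n _ ⟩
  ⌈ (m ∸ o) / n ⌉ * n + n   ∎
  where open ≤-Reasoning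

m∣n⇒m*⌈n/m⌉≡n : ∀ {m n} .{{_ : NonZero m}} → m ∣ n → m * ⌈ n / m ⌉ ≡ n
m∣n⇒m*⌈n/m⌉≡n {m} (divides q refl) = begin
  m * ⌈ q * m / m ⌉ ≡⟨ cong (λ w → m * w) (m≤c*n<m+n⇒⌈m/n⌉≡c q ≤-refl (m<m+n (q * m) (>-nonZero⁻¹ m))) ⟩
  m * q             ≡⟨ *-comm m q ⟩
  q * m             ∎
  where open ≡-Reasoning

⌈k/[k∸ℓ]⌉≡2 : ∀ {k ℓ} .{{_ : NonZero (k ∸ ℓ)}} → 0 < ℓ → 2 * ℓ ≤ k → ⌈ k / (k ∸ ℓ) ⌉ ≡ 2
⌈k/[k∸ℓ]⌉≡2 {k} {ℓ} 0<ℓ 2ℓ≤k = m≤c*n<m+n⇒⌈m/n⌉≡c 2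
  (begin
    k           ≡⟨ k≡ℓ+d ⟩
    ℓ + d       ≤⟨ +-monoˡ-≤ d ℓ≤d ⟩
    d + d       ≡⟨ cong (λ w → d + w) (+-identityʳ d) ⟨
    2 * d       ∎)
  (begin-strict
    2 * d       ≡⟨ cong (λ w → d + w) (+-identityʳ d) ⟩
    d + d       <⟨ +-monoˡ-< d (m<n+m d 0<ℓ) ⟩
    ℓ + d + d   ≡⟨ cong (_+ d) k≡ℓ+d ⟨
    k + d       ∎)
  where
  open ≤-Reasoning
  d : ℕ
  d = k ∸ ℓ
  k≡ℓ+d : k ≡ ℓ + d
  k≡ℓ+d = sym (m+[n∸m]≡n (≤-trans (m≤m+n ℓ (ℓ + 0)) 2ℓ≤k))
  ℓ≤d : ℓ ≤ d
  ℓ≤d = +-cancelˡ-≤ ℓ ℓ d (subst (ℓ + ℓ ≤_) k≡ℓ+d (subst (_≤ k) (cong (λ w → ℓ + w) (+-identityʳ ℓ)) 2ℓ≤k))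

[m*n+o]/n≡m : ∀ m {n o} .{{_ : NonZero n}} → o < n → (m * n + o) / n ≡ m
[m*n+o]/n≡m m {n} {o} o<n = begin
  (m * n + o) / n   ≡⟨ +-distrib-/-∣ˡ o (n∣m*n m) ⟩
  m * n / n + o / n ≡⟨ cong₂ _+_ (m*n/n≡m m n) (m<n⇒m/n≡0 o<n) ⟩
  m + 0             ≡⟨ +-identityʳ m ⟩
  m                 ∎
  where open ≡-Reasoning

*+-cancelʳ-≡ : ∀ m m' {n o o'} → o < n → o' < n → m * n + o ≡ m' * n + o' → m ≡ m'
*+-cancelʳ-≡ m m' {n} {o} {o'} o<n o'<n eq = begin
  m                 ≡⟨ sym ([m*n+o]/n≡m m o<n) ⟩
  (m * n + o) / n   ≡⟨ cong (_/ n) eq ⟩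
  (m' * n + o') / n ≡⟨ [m*n+o]/n≡m m' o'<n ⟩
  m'                ∎
  where
  open ≡-Reasoning
  instance
    n≢0 : NonZero n
    n≢0 = >-nonZero (<-≤-trans z<s o<n)

m<m/n*n+n : ∀ m n .{{_ : NonZero n}} → m < m / n * n + n
m<m/n*n+n m n = begin-strict
  m                 ≡⟨ m≡m%n+[m/n]*n m n ⟩
  m % n + m / n * n <⟨ +-monoˡ-< (m / n * n) (m%n<n m n) ⟩
  n + m / n * n     ≡⟨ +-comm n (m / n * n) ⟩
  m / n * n + n     ∎
  where open ≤-Reasoning

m<n+[o+p]⇒m∸o<n+p : ∀ {m} n o p → o ≤ m → m < n + (o + p) → m ∸ o < n + p
m<n+[o+p]⇒m∸o<n+p {m} n o p o≤m m< = begin-strict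
  m ∸ o             <⟨ ∸-monoˡ-< m< o≤m ⟩
  n + (o + p) ∸ o   ≡⟨ cong (_∸ o) (x∙yz≈y∙xz n o p) ⟩
  o + (n + p) ∸ o   ≡⟨ m+n∸m≡n o (n + p) ⟩
  n + p             ∎
  where open ≤-Reasoning

InWindow : ℕ → ℕ → ℕ → Set
InWindow L W y = L ≤ y × y < L + W

injective-inWindow⇒≤ : ∀ {a} L W (h : Fin a → ℕ) → (∀ {i j} → h i ≡ h j → i ≡ j) →
  (∀ i → InWindow L W (h i)) → a ≤ W
injective-inWindow⇒≤ {a} L W h h-inj h-inWindow = injective⇒≤ shift-injective
  where
  offset< : ∀ i → h i ∸ L < W
  offset< i with L≤hi , hi< ← h-inWindow i =
    subst (h i ∸ L <_) (m+n∸m≡n L W) (∸-monoˡ-< hi< L≤hi)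
  shift : Fin a → Fin W
  shift i = fromℕ< (offset< i)
  shift-injective : ∀ {i j} → shift i ≡ shift j → i ≡ j
  shift-injective {i} {j} eq = h-inj (∸-cancelʳ-≡ (proj₁ (h-inWindow i)) (proj₁ (h-inWindow j))
    (trans (sym (toℕ-fromℕ< (offset< i))) (trans (cong toℕ eq) (toℕ-fromℕ< (offset< j)))))

module _ {n} {x : Fin n} where

  ∈-⋃⁺ : ∀ {ps : List (Subset n)} → Any (x ∈_) ps → x ∈ ⋃ ps
  ∈-⋃⁺ (Any.here x∈p)   = x∈p∪q⁺ (inj₁ x∈p)
  ∈-⋃⁺ (Any.there x∈ps) = x∈p∪q⁺ (inj₂ (∈-⋃⁺ x∈ps))

  ∈-⋃⁻ : ∀ (ps : List (Subset n)) → x ∈ ⋃ ps → Any (x ∈_) ps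
  ∈-⋃⁻ []       x∈⊥ = ⊥-elim (∉⊥ x∈⊥)
  ∈-⋃⁻ (p ∷ ps) x∈∪ with x∈p∪q⁻ p (⋃ ps) x∈∪
  ... | inj₁ x∈p  = Any.here x∈p
  ... | inj₂ x∈ps = Any.there (∈-⋃⁻ ps x∈ps)

maxOver : ∀ {n} → (Fin n → ℕ) → Subset n → ℕ
maxOver g []            = 0
maxOver g (inside ∷ p)  = g Fin.zero ⊔ maxOver (g ∘ Fin.suc) p
maxOver g (outside ∷ p) = maxOver (g ∘ Fin.suc) p

maxOver-upper : ∀ {n} (g : Fin n → ℕ) {p x} → x ∈ p → g x ≤ maxOver g p
maxOver-upper g {inside ∷ p}  here        = m≤m⊔n _ _
maxOver-upper g {inside ∷ p}  (there x∈p) = ≤-trans (maxOver-upper (g ∘ Fin.suc) x∈p) (m≤n⊔m _ _)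
maxOver-upper g {outside ∷ p} (there x∈p) = maxOver-upper (g ∘ Fin.suc) x∈p

maxOver-lub : ∀ {n b} (g : Fin n → ℕ) p → (∀ x → g x ≤ b) → maxOver g p ≤ b
maxOver-lub g []            g≤b = z≤n
maxOver-lub g (inside ∷ p)  g≤b = ⊔-lub (g≤b Fin.zero) (maxOver-lub (g ∘ Fin.suc) p (g≤b ∘ Fin.suc))
maxOver-lub g (outside ∷ p) g≤b = maxOver-lub (g ∘ Fin.suc) p (g≤b ∘ Fin.suc)

maxOver-attained : ∀ {n c} (g : Fin n → ℕ) p → maxOver g p ≡ suc c → ∃ λ x → x ∈ p × g x ≡ suc c
maxOver-attained g (outside ∷ p) eq with x , x∈p , gx ← maxOver-attained (g ∘ Fin.suc) p eq =
  Fin.suc x , there x∈p , gx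
maxOver-attained g (inside ∷ p) eq with ⊔-sel (g Fin.zero) (maxOver (g ∘ Fin.suc) p)
... | inj₁ g₀≡max = Fin.zero , here , trans (sym g₀≡max) eq
... | inj₂ rest≡max with x , x∈p , gx ← maxOver-attained (g ∘ Fin.suc) p (trans (sym rest≡max) eq) =
  Fin.suc x , there x∈p , gx

module _ {N} (k ℓ : ℕ) (f : ℕ → Fin N) where

  ∈-edgeImage⁺ : ∀ i {j} → j < k → f (i * (k ∸ ℓ) + j) ∈ edgeImage k ℓ f i
  ∈-edgeImage⁺ i j<k = ∈-⋃⁺ (map⁺ (applyUpTo⁺ id (x∈⁅x⁆ _) j<k))

  ∈-edgeImage⁻ : ∀ i {x} → x ∈ edgeImage k ℓ f i → ∃ λ j → j < k × x ≡ f (i * (k ∸ ℓ) + j)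
  ∈-edgeImage⁻ i x∈e with j , j<k , x∈⁅fj⁆ ← applyUpTo⁻ id (map⁻ (∈-⋃⁻ _ x∈e)) =
    j , j<k , x∈⁅y⁆⇒x≡y _ x∈⁅fj⁆

pathVertex-decomposition : ∀ k d m {v} → d ≤ k → v < k + m * d →
  ∃₂ λ i j → i ≤ m × j < k × v ≡ i * d + j
pathVertex-decomposition k d zero {v} d≤k v< =
  0 , v , z≤n , subst (v <_) (+-identityʳ k) v< , refl
pathVertex-decomposition k d (suc m) {v} d≤k v< with v <? k
... | yes v<k = 0 , v , z≤n , v<k , refl
... | no v≮k with i , j , i≤m , j<k , eq ←
      pathVertex-decomposition k d m d≤k (m<n+[o+p]⇒m∸o<n+p k d (m * d) (≤-trans d≤k (≮⇒≥ v≮k)) v<)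
  = suc i , j , s≤s i≤m , j<k , (begin
    v                 ≡⟨ m+[n∸m]≡n d≤v ⟨
    d + (v ∸ d)       ≡⟨ cong (λ w → d + w) eq ⟩
    d + (i * d + j)   ≡⟨ +-assoc d (i * d) j ⟨
    suc i * d + j     ∎)
  where
  open ≡-Reasoning
  d≤v : d ≤ v
  d≤v = ≤-trans d≤k (≮⇒≥ v≮k)

edgeVertex<pathVertices : ∀ k ℓ {m i j} → i < m → j < k → i * (k ∸ ℓ) + j < pathVertices k ℓ m
edgeVertex<pathVertices k ℓ {suc m} {i} {j} (s≤s i≤m) j<k = begin-strict
  i * (k ∸ ℓ) + j ≤⟨ +-monoˡ-≤ j (*-monoˡ-≤ (k ∸ ℓ) i≤m) ⟩
  m * (k ∸ ℓ) + j <⟨ +-monoʳ-< (m * (k ∸ ℓ)) j<k ⟩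
  m * (k ∸ ℓ) + k ≡⟨ +-comm (m * (k ∸ ℓ)) k ⟩
  k + m * (k ∸ ℓ) ∎
  where open ≤-Reasoning

pathVertices≡ : ∀ {k ℓ} m → ℓ ≤ k → pathVertices k ℓ (suc m) ≡ ℓ + suc m * (k ∸ ℓ)
pathVertices≡ {k} {ℓ} m ℓ≤k = begin
  k + m * (k ∸ ℓ)             ≡⟨ cong (_+ m * (k ∸ ℓ)) (m+[n∸m]≡n ℓ≤k) ⟨
  ℓ + (k ∸ ℓ) + m * (k ∸ ℓ)   ≡⟨ +-assoc ℓ (k ∸ ℓ) (m * (k ∸ ℓ)) ⟩
  ℓ + suc m * (k ∸ ℓ)         ∎
  where open ≡-Reasoning

InjectiveBelow : ∀ {A : Set} → ℕ → (ℕ → A) → Set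
InjectiveBelow P f = ∀ a b → a < P → b < P → f a ≡ f b → a ≡ b

module _ {k N : ℕ} (ℓ : ℕ) {f : ℕ → Fin N} where

  pathCopyInWindow⇒≤ : ∀ m L W → InjectiveBelow (pathVertices k ℓ (suc m)) f →
    (∀ i {x} → i < suc m → x ∈ edgeImage k ℓ f i → InWindow L W (toℕ x)) →
    pathVertices k ℓ (suc m) ≤ W
  pathCopyInWindow⇒≤ m L W f-inj edges-inWindow = injective-inWindow⇒≤ L W image image-injective image-inWindow
    where
    image : Fin (pathVertices k ℓ (suc m)) → ℕ
    image v = toℕ (f (toℕ v))
    image-injective : ∀ {u v} → image u ≡ image v → u ≡ v
    image-injective eq = toℕ-injective (f-inj _ _ (toℕ<n _) (toℕ<n _) (toℕ-injective eq))
    image-inWindow : ∀ v → InWindow L W (image v)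
    image-inWindow v with i , j , i≤m , j<k , v≡ ← pathVertex-decomposition k (k ∸ ℓ) m (m∸n≤m k ℓ) (toℕ<n v) =
      edges-inWindow i (s≤s i≤m) (subst (λ w → f w ∈ edgeImage k ℓ f i) (sym v≡) (∈-edgeImage⁺ k ℓ f i j<k))

  spacedEdgesMeetWindow⇒≤ : ∀ m s T L W → InjectiveBelow (pathVertices k ℓ m) f →
    k ≤ s * (k ∸ ℓ) → (∀ q → q < T → q * s < m) →
    (∀ q → q < T → ∃ λ x → x ∈ edgeImage k ℓ f (q * s) × InWindow L W (toℕ x)) → T ≤ W
  spacedEdgesMeetWindow⇒≤ m s T L W f-inj k≤sd spaced hit =
    injective-inWindow⇒≤ L W hitVertex hitVertex-injective (λ q → proj₂ (proj₂ (hit (toℕ q) (toℕ<n q))))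
    where
    hitVertex : Fin T → ℕ
    hitVertex q = toℕ (proj₁ (hit (toℕ q) (toℕ<n q)))
    position : ∀ q → ∃ λ j → j < k × proj₁ (hit (toℕ q) (toℕ<n q)) ≡ f (toℕ q * s * (k ∸ ℓ) + j)
    position q = ∈-edgeImage⁻ k ℓ f (toℕ q * s) (proj₁ (proj₂ (hit (toℕ q) (toℕ<n q))))
    hitVertex-injective : ∀ {q q'} → hitVertex q ≡ hitVertex q' → q ≡ q'
    hitVertex-injective {q} {q'} eq with j , j<k , x≡ ← position q | j' , j'<k , x'≡ ← position q' =
      toℕ-injective (*+-cancelʳ-≡ (toℕ q) (toℕ q') (<-≤-trans j<k k≤sd) (<-≤-trans j'<k k≤sd) (begin
        toℕ q * (s * (k ∸ ℓ)) + j   ≡⟨ cong (_+ j) (*-assoc (toℕ q) s (k ∸ ℓ)) ⟨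
        toℕ q * s * (k ∸ ℓ) + j     ≡⟨ f-inj _ _ (edgeVertex<pathVertices k ℓ (spaced _ (toℕ<n q)) j<k)
                                                 (edgeVertex<pathVertices k ℓ (spaced _ (toℕ<n q')) j'<k)
                                                 (trans (sym x≡) (trans (toℕ-injective eq) x'≡)) ⟩
        toℕ q' * s * (k ∸ ℓ) + j'   ≡⟨ cong (_+ j') (*-assoc (toℕ q') s (k ∸ ℓ)) ⟩
        toℕ q' * (s * (k ∸ ℓ)) + j' ∎))
      where open ≡-Reasoning

block : (M B x : ℕ) → ℕ
block M zero    x = 0
block M (suc B) x with x <? M
... | yes _ = 0
... | no  _ = suc ((x ∸ M) / suc B)

blockStart : (M B c : ℕ) → ℕ
blockStart M B zero    = 0
blockStart M B (suc c) = M + c * B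

blockSize : (M B c : ℕ) → ℕ
blockSize M B zero    = M
blockSize M B (suc c) = B

block-inWindow : ∀ M B R {x} → x < M + R * B →
  InWindow (blockStart M B (block M B x)) (blockSize M B (block M B x)) x
block-inWindow M zero R {x} x< = z≤n , subst (x <_) (trans (cong (λ w → M + w) (*-zeroʳ R)) (+-identityʳ M)) x<
block-inWindow M (suc B) R {x} x< with x <? M
... | yes x<M = z≤n , x<M
... | no  x≮M = (begin
      M + c * suc B ≤⟨ +-monoʳ-≤ M (m/n*n≤m (x ∸ M) (suc B)) ⟩
      M + (x ∸ M)   ≡⟨ M+[x∸M]≡x ⟩
      x             ∎)
  , (begin-strict
      x                     ≡⟨ M+[x∸M]≡x ⟨
      M + (x ∸ M)           <⟨ +-monoʳ-< M (m<m/n*n+n (x ∸ M) (suc B)) ⟩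
      M + (c * suc B + suc B) ≡⟨ +-assoc M (c * suc B) (suc B) ⟨
      M + c * suc B + suc B ∎)
  where
  open ≤-Reasoning
  c : ℕ
  c = (x ∸ M) / suc B
  M+[x∸M]≡x : M + (x ∸ M) ≡ x
  M+[x∸M]≡x = m+[n∸m]≡n (≮⇒≥ x≮M)

block-≤ : ∀ M B R {x} → x < M + R * B → block M B x ≤ R
block-≤ M zero    R x< = z≤n
block-≤ M (suc B) R {x} x< with x <? M
... | yes _   = z≤n
... | no  x≮M = m<n*o⇒m/o<n (m<n+[o+p]⇒m∸o<n+p 0 M (R * suc B) (≮⇒≥ x≮M) x<)

module _ {k N} (G : KGraph k N) (M B R : ℕ) (N≤ : N ≤ M + R * B) where

  vertexBlock : Fin N → ℕ
  vertexBlock x = block M B (toℕ x)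

  vertexBlock-inWindow : ∀ {x c} → vertexBlock x ≡ c → InWindow (blockStart M B c) (blockSize M B c) (toℕ x)
  vertexBlock-inWindow {x} refl = block-inWindow M B R (<-≤-trans (toℕ<n x) N≤)

  maxBlockColouring : Colouring (suc R) G
  maxBlockColouring e _ = fromℕ< (s≤s (maxOver-lub vertexBlock e (λ x → block-≤ M B R (<-≤-trans (toℕ<n x) N≤))))

  maxBlockColouring-noMonoPath : ∀ ℓ m s → pathVertices k ℓ (suc m) ≡ suc M → k ≤ s * (k ∸ ℓ) →
    (∀ q → q < suc B → q * s < suc m) → ¬ MonoPathCopy ℓ (suc m) G maxBlockColouring
  maxBlockColouring-noMonoPath ℓ m s P≡ k≤sd spaced (f , f-inj , c , mono) =
    noCopyOfColour (toℕ c) λ i i<m → let _ , χ≡c = mono i i<m in trans (sym (toℕ-fromℕ< _)) (cong toℕ χ≡c)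
    where
    noCopyOfColour : ∀ c → (∀ i → i < suc m → maxOver vertexBlock (edgeImage k ℓ f i) ≡ c) → ⊥
    noCopyOfColour zero    edgeColour = 1+n≰n (subst (_≤ M) P≡ (pathCopyInWindow⇒≤ ℓ m 0 M f-inj λ i i<m x∈e →
      vertexBlock-inWindow (n≤0⇒n≡0 (subst (vertexBlock _ ≤_) (edgeColour i i<m) (maxOver-upper vertexBlock x∈e)))))
    noCopyOfColour (suc c) edgeColour = 1+n≰n (spacedEdgesMeetWindow⇒≤ ℓ (suc m) s (suc B) (M + c * B) B f-inj k≤sd spaced
      λ q q<T → let x , x∈e , x≡ = maxOver-attained vertexBlock _ (edgeColour (q * s) (spaced q q<T))
                in x , x∈e , vertexBlock-inWindow x≡)

-- Also covers ℕ→ℚ a, which is definitionally (+ a) /ℚ 1.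
toℚᵘ-/ℚ : ∀ a d → toℚᵘ ((+ a) /ℚ suc d) ≃ᵘ mkℚᵘ (+ a) d
toℚᵘ-/ℚ a d = ℚ.toℚᵘ-fromℚᵘ (mkℚᵘ (+ a) d)

ℕ→ℚ-homo-+ : ∀ a b → ℕ→ℚ (a + b) ≡ ℕ→ℚ a +ℚ ℕ→ℚ b
ℕ→ℚ-homo-+ a b = ℚ.toℚᵘ-injective (begin
  toℚᵘ (ℕ→ℚ (a + b))                 ≈⟨ toℚᵘ-/ℚ (a + b) 0 ⟩
  mkℚᵘ (+ (a + b)) 0                 ≈⟨ *≡* eq ⟩
  mkℚᵘ (+ a) 0 ℚᵘ.+ mkℚᵘ (+ b) 0     ≈⟨ ℚᵘ.+-cong (toℚᵘ-/ℚ a 0) (toℚᵘ-/ℚ b 0) ⟨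
  toℚᵘ (ℕ→ℚ a) ℚᵘ.+ toℚᵘ (ℕ→ℚ b)     ≈⟨ ℚ.toℚᵘ-homo-+ (ℕ→ℚ a) (ℕ→ℚ b) ⟨
  toℚᵘ (ℕ→ℚ a +ℚ ℕ→ℚ b)              ∎)
  where
  open ℚᵘ.≃-Reasoning
  eq : + (a + b) ℤ.* + 1 ≡ (+ a ℤ.* + 1 ℤ.+ + b ℤ.* + 1) ℤ.* + 1
  eq = trans (cong (ℤ._* + 1) (ℤ.pos-+ a b)) (ring (+ a) (+ b))
    where
    ring : ∀ x y → (x ℤ.+ y) ℤ.* + 1 ≡ (x ℤ.* + 1 ℤ.+ y ℤ.* + 1) ℤ.* + 1
    ring = solve-∀

ℕ→ℚ-cancel-≤ : ∀ {a b} → ℕ→ℚ a ≤ℚ ℕ→ℚ b → a ≤ b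
ℕ→ℚ-cancel-≤ {a} {b} a≤b with *≤* a*1≤b*1 ← ℚᵘ.≤-respˡ-≃ (toℚᵘ-/ℚ a 0) (ℚᵘ.≤-respʳ-≃ (toℚᵘ-/ℚ b 0) (ℚ.toℚᵘ-mono-≤ a≤b)) =
  ℤ.drop‿+≤+ (subst₂ ℤ._≤_ (ℤ.*-identityʳ (+ a)) (ℤ.*-identityʳ (+ b)) a*1≤b*1)

ℕ→ℚ-≤-difference⇒+≤ : ∀ {a b c} → ℕ→ℚ a ≤ℚ ℕ→ℚ b -ℚ ℕ→ℚ c → a + c ≤ b
ℕ→ℚ-≤-difference⇒+≤ {a} {b} {c} a≤b-c = ℕ→ℚ-cancel-≤ (begin
  ℕ→ℚ (a + c)               ≡⟨ ℕ→ℚ-homo-+ a c ⟩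
  ℕ→ℚ a +ℚ ℕ→ℚ c            ≤⟨ ℚ.+-monoˡ-≤ (ℕ→ℚ c) a≤b-c ⟩
  ℕ→ℚ b -ℚ ℕ→ℚ c +ℚ ℕ→ℚ c   ≡⟨ solve 2 (λ b c → b :- c :+ c := b) refl (ℕ→ℚ b) (ℕ→ℚ c) ⟩
  ℕ→ℚ b                     ∎)
  where
  open ℚ.≤-Reasoning
  open +-*-Solver

/ℚ-split : ∀ a d → (+ (a + suc d)) /ℚ suc d ≡ 1ℚ +ℚ (+ a) /ℚ suc d
/ℚ-split a d = ℚ.toℚᵘ-injective (begin
  toℚᵘ ((+ (a + suc d)) /ℚ suc d)             ≈⟨ toℚᵘ-/ℚ (a + suc d) d ⟩
  mkℚᵘ (+ (a + suc d)) d                      ≈⟨ *≡* eq ⟩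
  mkℚᵘ (+ 1) 0 ℚᵘ.+ mkℚᵘ (+ a) d              ≈⟨ ℚᵘ.+-cong (toℚᵘ-/ℚ 1 0) (toℚᵘ-/ℚ a d) ⟨
  toℚᵘ 1ℚ ℚᵘ.+ toℚᵘ ((+ a) /ℚ suc d)          ≈⟨ ℚ.toℚᵘ-homo-+ 1ℚ ((+ a) /ℚ suc d) ⟨
  toℚᵘ (1ℚ +ℚ (+ a) /ℚ suc d)                 ∎)
  where
  open ℚᵘ.≃-Reasoning
  ring : ∀ x y → (x ℤ.+ y) ℤ.* (+ 1 ℤ.* y) ≡ (+ 1 ℤ.* y ℤ.+ x ℤ.* + 1) ℤ.* y
  ring = solve-∀
  eq : + (a + suc d) ℤ.* (+ 1 ℤ.* + suc d) ≡ (+ 1 ℤ.* + suc d ℤ.+ + a ℤ.* + 1) ℤ.* + suc d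
  eq = trans (cong (ℤ._* (+ 1 ℤ.* + suc d)) (ℤ.pos-+ a (suc d))) (ring (+ a) (+ suc d))

/ℚ-*-≤ : ∀ a x y d → a * x ≤ y * suc d → ((+ a) /ℚ suc d) *ℚ ℕ→ℚ x ≤ℚ ℕ→ℚ y
/ℚ-*-≤ a x y d ax≤yd = ℚ.toℚᵘ-cancel-≤ (begin
  toℚᵘ (((+ a) /ℚ suc d) *ℚ ℕ→ℚ x)          ≃⟨ ℚ.toℚᵘ-homo-* ((+ a) /ℚ suc d) (ℕ→ℚ x) ⟩
  toℚᵘ ((+ a) /ℚ suc d) ℚᵘ.* toℚᵘ (ℕ→ℚ x)   ≃⟨ ℚᵘ.*-cong (toℚᵘ-/ℚ a d) (toℚᵘ-/ℚ x 0) ⟩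
  mkℚᵘ (+ a) d ℚᵘ.* mkℚᵘ (+ x) 0            ≤⟨ *≤* cross ⟩
  mkℚᵘ (+ y) 0                              ≃⟨ toℚᵘ-/ℚ y 0 ⟨
  toℚᵘ (ℕ→ℚ y)                              ∎)
  where
  open ℚᵘ.≤-Reasoning
  cross : (+ a ℤ.* + x) ℤ.* + 1 ℤ.≤ + y ℤ.* (+ suc d ℤ.* + 1)
  cross = subst₂ ℤ._≤_ (trans (ℤ.pos-* a x) (sym (ℤ.*-identityʳ _)))
                       (trans (ℤ.pos-* y (suc d)) (cong (+ y ℤ.*_) (sym (ℤ.*-identityʳ (+ suc d)))))
                       (ℤ.+≤+ ax≤yd)

linearBound : ℚ → ℕ → ℕ → ℚ
linearBound slope n r = slope *ℚ ℕ→ℚ n -ℚ ℕ→ℚ (2 * r) +ℚ 1ℚ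

linearBound≤ : ∀ R T n D .{{_ : NonZero D}} → n ≤ T * D + D →
  linearBound (1ℚ +ℚ (+ R) /ℚ D) n (suc R) ≤ℚ ℕ→ℚ (R * T + n) -ℚ ℕ→ℚ (suc R)
-- The gap is R·T + R − (R/D)·n, which is nonnegative because n ≤ (T + 1)·D.
linearBound≤ R T n (suc D) n≤ = begin
  linearBound (1ℚ +ℚ u) n (suc R)  ≡⟨ cong (λ z → (1ℚ +ℚ u) *ℚ n' -ℚ z +ℚ 1ℚ) 2[1+R]≡ ⟩
  (1ℚ +ℚ u) *ℚ n' -ℚ ((1ℚ +ℚ R') +ℚ (1ℚ +ℚ R')) +ℚ 1ℚ
                                   ≡⟨ solve 4 (λ u n' R' P → (con 1ℚ :+ u) :* n' :- ((con 1ℚ :+ R') :+ (con 1ℚ :+ R')) :+ con 1ℚ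
                                                := (P :+ n' :- (con 1ℚ :+ R')) :+ u :* n' :- (P :+ R')) refl u n' R' P ⟩
  A +ℚ u *ℚ n' -ℚ (P +ℚ R')        ≤⟨ ℚ.+-monoˡ-≤ (- (P +ℚ R')) (ℚ.+-monoʳ-≤ A un≤P+R) ⟩
  A +ℚ (P +ℚ R') -ℚ (P +ℚ R')      ≡⟨ solve 2 (λ A X → A :+ X :- X := A) refl A (P +ℚ R') ⟩
  A                                ≡⟨ cong₂ _-ℚ_ (ℕ→ℚ-homo-+ (R * T) n) (ℕ→ℚ-homo-+ 1 R) ⟨
  ℕ→ℚ (R * T + n) -ℚ ℕ→ℚ (suc R)  ∎
  where
  open ℚ.≤-Reasoning
  open +-*-Solver
  u n' R' P A : ℚ
  u = (+ R) /ℚ suc D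
  n' = ℕ→ℚ n
  R' = ℕ→ℚ R
  P = ℕ→ℚ (R * T)
  A = P +ℚ n' -ℚ (1ℚ +ℚ R')
  2[1+R]≡ : ℕ→ℚ (2 * suc R) ≡ (1ℚ +ℚ R') +ℚ (1ℚ +ℚ R')
  2[1+R]≡ = trans (cong (λ w → ℕ→ℚ (suc R + w)) (+-identityʳ (suc R)))
                  (trans (ℕ→ℚ-homo-+ (suc R) (suc R)) (cong₂ _+ℚ_ (ℕ→ℚ-homo-+ 1 R) (ℕ→ℚ-homo-+ 1 R)))
  un≤P+R : u *ℚ n' ≤ℚ P +ℚ R'
  un≤P+R = subst (u *ℚ n' ≤ℚ_) (ℕ→ℚ-homo-+ (R * T) R)
    (/ℚ-*-≤ R n (R * T + R) D (≤-trans (*-monoʳ-≤ R n≤) (≤-reflexive (distrib R T (suc D)))))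
    where
    distrib : ∀ R T D → R * (T * D + D) ≡ (R * T + R) * D
    distrib = ℕ-Ring.solve-∀

linearBound-slope : ∀ R {K D} n → 0 < K → D ≡ K →
  linearBound ((+ (R + K)) /ℚ K) n (suc R) ≡ linearBound (1ℚ +ℚ (+ R) /ℚ D) n (suc R)
linearBound-slope R {suc K} n _ refl = cong (λ slope → linearBound slope n (suc R)) (/ℚ-split R K)

RamseyGreater-weaken : ∀ {r k ℓ m p q} → p ≤ℚ q → RamseyGreater r k ℓ m q → RamseyGreater r k ℓ m p
RamseyGreater-weaken p≤q R>q N N≤p = R>q N (ℚ.≤-trans N≤p p≤q)

RamseyGreater-spacedEdges : ∀ R k ℓ m s T → 0 < k → k ≤ s * (k ∸ ℓ) → 0 < T →
  (∀ q → q < T → q * s < suc m) →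
  RamseyGreater (suc R) k ℓ (suc m) (ℕ→ℚ (R * T + pathVertices k ℓ (suc m)) -ℚ ℕ→ℚ (suc R))
RamseyGreater-spacedEdges R (suc k) ℓ m s (suc B) _ k≤sd _ spaced N N≤A G arrows =
  maxBlockColouring-noMonoPath G M B R N≤ ℓ m s refl k≤sd spaced (arrows (maxBlockColouring G M B R N≤))
  where
  M : ℕ
  M = k + m * (suc k ∸ ℓ)
  N≤ : N ≤ M + R * B
  N≤ = +-cancelʳ-≤ (suc R) N (M + R * B)
    (subst (N + suc R ≤_) (rearrange R B M) (ℕ→ℚ-≤-difference⇒+≤ {N} {R * suc B + suc M} {suc R} N≤A))
    where
    rearrange : ∀ R B M → R * suc B + suc M ≡ M + R * B + suc R
    rearrange = ℕ-Ring.solve-∀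

RamseyGreater-path : ∀ R k ℓ m → 0 < k → ℓ < k →
  let d = k ∸ ℓ
      n = ℓ + suc m * d
  in RamseyGreater (suc R) k ℓ (suc m) (ℕ→ℚ (R * ⌈ (n ∸ ℓ) / (d * ⌈ k / d ⌉) ⌉ + n) -ℚ ℕ→ℚ (suc R))
RamseyGreater-path R k ℓ m 0<k ℓ<k =
  subst (λ p → RamseyGreater (suc R) k ℓ (suc m) (ℕ→ℚ (R * T + p) -ℚ ℕ→ℚ (suc R)))
    (pathVertices≡ m (<⇒≤ ℓ<k))
    (RamseyGreater-spacedEdges R k ℓ m c T 0<k (m≤⌈m/n⌉*n k d) (⌈m/n⌉>0 D 0<n∸ℓ) spaced)
  where
  d c D n T : ℕ
  d = k ∸ ℓ
  c = ⌈ k / d ⌉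
  D = d * c
  n = ℓ + suc m * d
  T = ⌈ (n ∸ ℓ) / D ⌉
  0<d : 0 < d
  0<d = m<n⇒0<n∸m ℓ<k
  instance
    d≢0 : NonZero d
    d≢0 = >-nonZero 0<d
    D≢0 : NonZero D
    D≢0 = >-nonZero (<-≤-trans 0<k (m≤n*⌈m/n⌉ k d))
  n∸ℓ≡ : n ∸ ℓ ≡ suc m * d
  n∸ℓ≡ = m+n∸m≡n ℓ (suc m * d)
  0<n∸ℓ : 0 < n ∸ ℓ
  0<n∸ℓ = subst (0 <_) (sym n∸ℓ≡) (<-≤-trans 0<d (m≤m+n d (m * d)))
  spaced : ∀ q → q < T → q * c < suc m
  spaced q q<T = *-cancelʳ-< d (q * c) (suc m)
    (subst₂ _<_ (trans (cong (λ w → q * w) (*-comm d c)) (sym (*-assoc q c d))) n∸ℓ≡ (q<⌈m/n⌉⇒q*n<m q<T))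

proposition2p1 : (r k ℓ m : ℕ) → 2 ≤ r → 2 ≤ k → 1 ≤ ℓ → ℓ < k → 1 ≤ m →
    let n = ℓ + m * (k ∸ ℓ)
        D = (k ∸ ℓ) * ⌈ k / (k ∸ ℓ) ⌉
        A = ℕ→ℚ ((r ∸ 1) * ⌈ (n ∸ ℓ) / D ⌉ + n) -ℚ ℕ→ℚ r
    in RamseyGreater r k ℓ m A
       × ((1ℚ +ℚ ((+ (r ∸ 1)) /ℚ D)) *ℚ ℕ→ℚ n -ℚ ℕ→ℚ (2 * r) +ℚ 1ℚ) ≤ℚ A
       × ((k ∸ ℓ) ∣ k → RamseyGreater r k ℓ m
            ((((+ (r ∸ 1 + k)) /ℚ k) *ℚ ℕ→ℚ n) -ℚ ℕ→ℚ (2 * r) +ℚ 1ℚ))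
       × (2 * ℓ ≤ k → RamseyGreater r k ℓ m
            ((((+ (r ∸ 1 + 2 * (k ∸ ℓ))) /ℚ (2 * (k ∸ ℓ))) *ℚ ℕ→ℚ n) -ℚ ℕ→ℚ (2 * r) +ℚ 1ℚ))
proposition2p1 (suc R) k ℓ (suc m) _ 2≤k 1≤ℓ ℓ<k _ = lower , linear , divisible , short
  where
  d D n T : ℕ
  d = k ∸ ℓ
  D = d * ⌈ k / d ⌉
  n = ℓ + suc m * d
  T = ⌈ (n ∸ ℓ) / D ⌉
  0<k : 0 < k
  0<k = <-≤-trans z<s 2≤k
  0<d : 0 < d
  0<d = m<n⇒0<n∸m ℓ<k
  instance
    d≢0 : NonZero d
    d≢0 = >-nonZero 0<d
    D≢0 : NonZero D
    D≢0 = >-nonZero (<-≤-trans 0<k (m≤n*⌈m/n⌉ k d))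
  lower : RamseyGreater (suc R) k ℓ (suc m) (ℕ→ℚ (R * T + n) -ℚ ℕ→ℚ (suc R))
  lower = RamseyGreater-path R k ℓ m 0<k ℓ<k
  linear : linearBound (1ℚ +ℚ (+ R) /ℚ D) n (suc R) ≤ℚ ℕ→ℚ (R * T + n) -ℚ ℕ→ℚ (suc R)
  linear = linearBound≤ R T n D (m≤⌈[m∸o]/n⌉*n+n n (≤-trans (<⇒≤ ℓ<k) (m≤n*⌈m/n⌉ k d)))
  divisible : d ∣ k → RamseyGreater (suc R) k ℓ (suc m) (linearBound ((+ (R + k)) /ℚ k) n (suc R))
  divisible d∣k = RamseyGreater-weaken {ℓ = ℓ}
    (ℚ.≤-trans (ℚ.≤-reflexive (linearBound-slope R n 0<k (m∣n⇒m*⌈n/m⌉≡n d∣k))) linear) lower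
  short : 2 * ℓ ≤ k → RamseyGreater (suc R) k ℓ (suc m) (linearBound ((+ (R + 2 * d)) /ℚ (2 * d)) n (suc R))
  short 2ℓ≤k = RamseyGreater-weaken {ℓ = ℓ}
    (ℚ.≤-trans (ℚ.≤-reflexive (linearBound-slope R n (*-monoʳ-< 2 0<d) D≡2d)) linear) lower
    where
    D≡2d : D ≡ 2 * d
    D≡2d = trans (cong (λ w → d * w) (⌈k/[k∸ℓ]⌉≡2 1≤ℓ 2ℓ≤k)) (*-comm d 2)
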